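{- Let $a,b$ be coprime positive integers and $D$ an $a,b$-Dyck path with $\pi(D)=(P,Q)$. Then $P$ and $Q$ are mutually noncrossing.
   Context: An $a,b$-Dyck path is a lattice path from $(0,0)$ to $(b,a)$ with unit north steps $N$ and east steps $E$ staying above the line $y=\frac{a}{b}x$; write it as $D=N^{v_0}EN^{v_1}E\cdots N^{v_{b-1}}E$, $v_i\ge 0$. A vertical run of length $v$ is a $P$-rise if $v>a/b$ and a $Q$-rise if $v<a/b$. For $1\le i\le b-1$ the label $i$ is the point $(i,v_0+\dots+v_{i-1})$. If $v_i>0$, the laser $\ell(i)$ is the segment of slope $a/b$ from label $i$ going northeast until it next meets $D$ (in the interior of an east step). $\ell(D)$ is the set of pairs $(i,j)$ with $\ell(i)$ ending on the east step whose west endpoint has $x$-coordinate $j$. The pair $\pi(D)=(P,Q)$ of set partitions of $[b-1]$: $i,j$ in the same block of $P$ iff labels $i,j$ are not separated by any laser (label $k$ lies strictly below $\ell(k)$); $Q$ is the equivalence relation generated by $i\sim j$ whenever $\ell(i),\ell(j)$ end on the same east step immediately following a $Q$-rise, or $(i,j)\in\ell(D)$, or $(j,i)\in\ell(D)$. Two partitions $P_1,P_2$ of $[n]$ are mutually noncrossing if there are no $x<y<z<w$ with $x,z$ in one block of $P_i$ and $y,w$ in one block of $P_j$ where $\{i,j\}=\{1,2\}$. -}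

module Defs where

open import Data.Nat using (ℕ; zero; suc; _+_; _*_; _∸_; _≤_; _<_)
open import Data.List using (List; []; _∷_; length)
open import Data.Nat.ListAction using (sum)
open import Data.Product using (_×_; Σ; ∃)
open import Data.Sum using (_⊎_)
open import Relation.Nullary using (¬_)
open import Relation.Binary.PropositionalEquality using (_≡_)
open import Relation.Binary.Construct.Closure.Equivalence using (EqClosure)

-- A lattice path D = N^{v_0} E N^{v_1} E ... N^{v_{b-1}} E is given by the
-- list (v_0, ..., v_{b-1}) of its vertical run lengths.

-- v_i  (indices past the end give 0; only used for i < b)
run : List ℕ → ℕ → ℕ
run []       _       = 0
run (x ∷ xs) zero    = x
run (x ∷ xs) (suc i) = run xs i

-- s_i = v_0 + ... + v_{i-1}; label i is the lattice point (i , s_i),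
-- and the east step with west endpoint x-coordinate m lies at height s_{m+1}.
ht : List ℕ → ℕ → ℕ
ht _        zero    = 0
ht []       (suc i) = 0
ht (x ∷ xs) (suc i) = x + ht xs i

-- a,b-Dyck path: a lattice path from (0,0) to (b,a) (b east steps, a north
-- steps) all of whose lattice points (x,y) satisfy y ≥ (a/b) x, i.e.
-- a*x ≤ b*y; it suffices to require this of the lowest point (i , s_i) of
-- each column x = i.
record IsDyck (a b : ℕ) (v : List ℕ) : Set where
  field
    len   : length v ≡ b
    total : sum v ≡ a
    above : ∀ i → i ≤ b → a * i ≤ b * ht v i

module _ (a b : ℕ) (v : List ℕ) where

  -- b times the height of the line of slope a/b through label k, at x
  -- (for x ≥ k).
  laserH : ℕ → ℕ → ℕ
  laserH k x = b * ht v k + a * (x ∸ k)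

  -- LaserEnds k m : v_k > 0, so the laser ℓ(k) exists, and ℓ(k) ends on the
  -- east step with west endpoint x-coordinate m: the laser stays strictly
  -- below the path on the columns k < x ≤ m (so it does not meet D before),
  -- and crosses the height s_{m+1} of that east step strictly between
  -- x = m and x = m + 1 (i.e. in its interior).
  LaserEnds : ℕ → ℕ → Set
  LaserEnds k m =
    0 < run v k × k ≤ m × m < b ×
    (∀ m′ → k ≤ m′ → m′ < m → laserH k (suc m′) < b * ht v (suc m′)) ×
    laserH k m < b * ht v (suc m) ×
    b * ht v (suc m) < laserH k (suc m)

  -- Label k itself is
  -- never above ℓ(k) (it lies below its own laser by convention).
  AboveLaser : ℕ → ℕ → Set
  AboveLaser k i = Σ ℕ λ m → LaserEnds k m × k < i × i ≤ m × laserH k i < b * ht v i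

  Separates : ℕ → ℕ → ℕ → Set
  Separates k i j = (AboveLaser k i × ¬ AboveLaser k j) ⊎ (AboveLaser k j × ¬ AboveLaser k i)

  Label : ℕ → Set
  Label i = 1 ≤ i × i < b

  PRel : ℕ → ℕ → Set
  PRel i j = ∀ k → Label k → ¬ Separates k i j

  QRise : ℕ → Set
  QRise m = b * run v m < a

  QGen : ℕ → ℕ → Set
  QGen i j = Label i × Label j ×
    ((Σ ℕ λ m → LaserEnds i m × LaserEnds j m × QRise m)
     ⊎ LaserEnds i j ⊎ LaserEnds j i)

  QRel : ℕ → ℕ → Set
  QRel = EqClosure QGen

MutuallyNoncrossing : ℕ → (ℕ → ℕ → Set) → (ℕ → ℕ → Set) → Set
MutuallyNoncrossing n R₁ R₂ =
  ∀ x y z w → 1 ≤ x → x < y → y < z → z < w → w ≤ n →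
    ¬ (R₁ x z × R₂ y w) × ¬ (R₂ x z × R₁ y w)

-- A laser ℓ(k) ending over column m has exactly the labels of (k, m] above
-- it, so no P-block has one element inside (k, m] and one outside.  Hence if
-- x and z share a P-block, the interval [x, z) contains both endpoints k and
-- m of ℓ(k) or neither.  Every generator of Q joins two such endpoints (two
-- lasers ending on the same east step share m), so a Q-block meets [x, z)
-- entirely or not at all; a crossing x < y < z < w would have y inside and w
-- outside.
module Submission where

open import Defs
open import Data.Nat using (ℕ; _<_; _∸_)
open import Data.List using (List)
open import Data.Nat.Coprimality using (Coprime)

open import Data.Nat using (suc; _≤_; _≤?_; _<?_; s≤s)
open import Data.Nat.Properties using (≤-trans; ≤-<-trans; <⇒≤; ≮⇒≥; ≰⇒>; <⇒≱; <-asym; ≤-antisym)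
open import Data.Product using (_×_; _,_; proj₁; proj₂)
open import Data.Sum using (inj₁; inj₂)
open import Function.Base using (_∘_)
open import Function.Bundles using (_⇔_; mk⇔; Equivalence)
open import Function.Construct.Symmetry using (⇔-sym)
open import Function.Construct.Composition using (_⇔-∘_)
open import Function.Properties.Equivalence using (⇔-isEquivalence)
open import Relation.Nullary using (Dec; yes; no; ¬_; contradiction)
open import Relation.Nullary.Decidable using (_×-dec_; decidable-stable)
open import Relation.Binary.PropositionalEquality using (_≡_; sym; subst)
open import Relation.Binary.Construct.Closure.Equivalence using (gfold)

_∈⟨_⋯_] : ℕ → ℕ → ℕ → Set
t ∈⟨ k ⋯ m ] = k < t × t ≤ m

_∈[_⋯_⟩ : ℕ → ℕ → ℕ → Set
t ∈[ x ⋯ z ⟩ = x ≤ t × t < z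

_∈⟨_⋯_]? : ∀ t k m → Dec (t ∈⟨ k ⋯ m ])
t ∈⟨ k ⋯ m ]? = (k <? t) ×-dec (t ≤? m)

∈⟨⋯]-⇔⇒∈[⋯⟩-⇔ : ∀ {x z k m} → k ≤ m →
                 x ∈⟨ k ⋯ m ] ⇔ z ∈⟨ k ⋯ m ] → k ∈[ x ⋯ z ⟩ ⇔ m ∈[ x ⋯ z ⟩
∈⟨⋯]-⇔⇒∈[⋯⟩-⇔ {x} {z} {k} {m} k≤m x⇔z = mk⇔ to from
  where
  open Equivalence x⇔z renaming (to to x⇒z; from to z⇒x)

  to : k ∈[ x ⋯ z ⟩ → m ∈[ x ⋯ z ⟩
  to (x≤k , k<z) = ≤-trans x≤k k≤m , m<z
    where
    m<z : m < z
    m<z with m <? z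
    ... | yes m<z = m<z
    ... | no m≮z = contradiction x≤k (<⇒≱ (proj₁ (z⇒x (k<z , ≮⇒≥ m≮z))))

  from : m ∈[ x ⋯ z ⟩ → k ∈[ x ⋯ z ⟩
  from (x≤m , m<z) = x≤k , ≤-<-trans k≤m m<z
    where
    x≤k : x ≤ k
    x≤k with x ≤? k
    ... | yes x≤k = x≤k
    ... | no x≰k = contradiction (proj₂ (x⇒z (≰⇒> x≰k , x≤m))) (<⇒≱ m<z)

module _ {a b : ℕ} {v : List ℕ} where

  laserEnds-unique : ∀ {k m m′} → LaserEnds a b v k m → LaserEnds a b v k m′ → m ≡ m′
  laserEnds-unique L L′ = ≤-antisym (end-≤ L L′) (end-≤ L′ L)
    where
    end-≤ : ∀ {k m m′} → LaserEnds a b v k m → LaserEnds a b v k m′ → m ≤ m′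
    end-≤ (_ , _ , _ , below , _ , _) (_ , k≤m′ , _ , _ , _ , crosses′) =
      ≮⇒≥ λ m′<m → <-asym crosses′ (below _ k≤m′ m′<m)

  aboveLaser⇔∈⟨⋯] : ∀ {k m t} → LaserEnds a b v k m → AboveLaser a b v k t ⇔ t ∈⟨ k ⋯ m ]
  aboveLaser⇔∈⟨⋯] {k} {m} L@(_ , _ , _ , below , _ , _) = mk⇔ to from
    where
    to : ∀ {t} → AboveLaser a b v k t → t ∈⟨ k ⋯ m ]
    to {t} (_ , L′ , k<t , t≤m′ , _) = k<t , subst (t ≤_) (sym (laserEnds-unique L L′)) t≤m′

    from : ∀ {t} → t ∈⟨ k ⋯ m ] → AboveLaser a b v k t
    from {suc t} (s≤s k≤t , t<m) = m , L , s≤s k≤t , t<m , below t k≤t t<m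

  pRel⇒∈⟨⋯]-⇔ : ∀ {x z k m} → PRel a b v x z → Label a b v k → LaserEnds a b v k m →
                x ∈⟨ k ⋯ m ] ⇔ z ∈⟨ k ⋯ m ]
  pRel⇒∈⟨⋯]-⇔ {x} {z} {k} {m} x~z k-label L = mk⇔
    (λ x∈ → decidable-stable (z ∈⟨ k ⋯ m ]?) λ z∉ → x~z k k-label (inj₁ (above x∈ , z∉ ∘ inside)))
    (λ z∈ → decidable-stable (x ∈⟨ k ⋯ m ]?) λ x∉ → x~z k k-label (inj₂ (above z∈ , x∉ ∘ inside)))
    where
    above : ∀ {t} → t ∈⟨ k ⋯ m ] → AboveLaser a b v k t
    above = Equivalence.from (aboveLaser⇔∈⟨⋯] L)

    inside : ∀ {t} → AboveLaser a b v k t → t ∈⟨ k ⋯ m ]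
    inside = Equivalence.to (aboveLaser⇔∈⟨⋯] L)

  pRel⇒laserEnds-∈[⋯⟩-⇔ : ∀ {x z k m} → PRel a b v x z → Label a b v k → LaserEnds a b v k m →
                          k ∈[ x ⋯ z ⟩ ⇔ m ∈[ x ⋯ z ⟩
  pRel⇒laserEnds-∈[⋯⟩-⇔ x~z k-label L@(_ , k≤m , _) =
    ∈⟨⋯]-⇔⇒∈[⋯⟩-⇔ k≤m (pRel⇒∈⟨⋯]-⇔ x~z k-label L)

  pRel⇒qGen-∈[⋯⟩-⇔ : ∀ {x z i j} → PRel a b v x z → QGen a b v i j → i ∈[ x ⋯ z ⟩ ⇔ j ∈[ x ⋯ z ⟩
  pRel⇒qGen-∈[⋯⟩-⇔ x~z (i-label , j-label , inj₁ (_ , Lᵢ , Lⱼ , _)) =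
    ⇔-sym (pRel⇒laserEnds-∈[⋯⟩-⇔ x~z j-label Lⱼ) ⇔-∘ pRel⇒laserEnds-∈[⋯⟩-⇔ x~z i-label Lᵢ
  pRel⇒qGen-∈[⋯⟩-⇔ x~z (i-label , _ , inj₂ (inj₁ L)) = pRel⇒laserEnds-∈[⋯⟩-⇔ x~z i-label L
  pRel⇒qGen-∈[⋯⟩-⇔ x~z (_ , j-label , inj₂ (inj₂ L)) = ⇔-sym (pRel⇒laserEnds-∈[⋯⟩-⇔ x~z j-label L)

  pRel⇒qRel-∈[⋯⟩-⇔ : ∀ {x z i j} → PRel a b v x z → QRel a b v i j → i ∈[ x ⋯ z ⟩ ⇔ j ∈[ x ⋯ z ⟩
  pRel⇒qRel-∈[⋯⟩-⇔ {x} {z} x~z =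
    gfold ⇔-isEquivalence (λ t → t ∈[ x ⋯ z ⟩) (pRel⇒qGen-∈[⋯⟩-⇔ x~z)

proposition3p5 : (a b : ℕ) → 0 < a → 0 < b → Coprime a b →
    (v : List ℕ) → IsDyck a b v →
    MutuallyNoncrossing (b ∸ 1) (PRel a b v) (QRel a b v)
proposition3p5 a b _ _ _ v _ x y z w _ x<y y<z z<w _ = pq-crossing , qp-crossing
  where
  pq-crossing : ¬ (PRel a b v x z × QRel a b v y w)
  pq-crossing (x~z , y≈w) =
    <-asym z<w (proj₂ (Equivalence.to (pRel⇒qRel-∈[⋯⟩-⇔ x~z y≈w) (<⇒≤ x<y , y<z)))

  qp-crossing : ¬ (QRel a b v x z × PRel a b v y w)
  qp-crossing (x≈z , y~w) =
    <⇒≱ x<y (proj₁ (Equivalence.from (pRel⇒qRel-∈[⋯⟩-⇔ y~w x≈z) (<⇒≤ y<z , z<w)))
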